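{- Let $\xi_1,\xi_2,\xi\in\mathbf{RC}$ and let $\{\xi_i\}_{i\in I}\subseteq\mathbf{RC}$. Then $\xi_1\times\xi_2$, $\xi_1+\xi_2$, $\xi_1\Rightarrow\xi_2$, $\xi_1\ltimes\xi_2$, ${\sim}\xi$, $\prod_{i\in I}\xi_i$ and $\sum_{i\in I}\xi_i$ are reducibility candidates.
   Context: Untyped terms: $a,b,c ::= x \mid a\mathbin{\#}b \mid \langle a,b\rangle \mid \pi_i(a) \mid \mathrm{in}_i(a) \mid \mathrm{case}\,a\,[x.b\mid y.c] \mid \lambda x.a \mid a\,b \mid \langle\!\langle a,b\rangle\!\rangle \mid \mathrm{colam}\,a\,[x,y.b] \mid \neg\mathrm{I}(a) \mid \neg\mathrm{E}(a) \mid \Lambda\Diamond.a \mid a[\Diamond] \mid \langle\Diamond,a\rangle \mid \mathrm{open}\,a\text{ as }x\text{ in }b$ ($i\in\{1,2\}$, $\Diamond$ a fixed placeholder symbol; evident binders). Let $a\mathbin{\#\!\#}b := (a\,b)\mathbin{\#}(b\,a)$. The reduction $\to_U$ is the closure under arbitrary contexts of: $\pi_i\langle a_1,a_2\rangle\to a_i$; $\mathrm{case}(\mathrm{in}_i a)[x.b_1\mid x.b_2]\to b_i[x:=a]$; $(\lambda x.a)\,b\to a[x:=b]$; $\mathrm{colam}\langle\!\langle a_1,a_2\rangle\!\rangle[x,y.b]\to b[x:=a_1][y:=a_2]$; $\neg\mathrm{E}(\neg\mathrm{I}\,a)\to a$; $(\Lambda\Diamond.a)[\Diamond]\to a$; $\mathrm{open}\langle\Diamond,a\rangle\text{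 as }x\text{ in }b\to b[x:=a]$; $\langle a_1,a_2\rangle\mathbin{\#}\mathrm{in}_i b\to a_i\mathbin{\#\!\#}b$; $\mathrm{in}_i a\mathbin{\#}\langle b_1,b_2\rangle\to a\mathbin{\#\!\#}b_i$; $(\lambda x.a)\mathbin{\#}\langle\!\langle b,c\rangle\!\rangle\to a[x:=b]\mathbin{\#\!\#}c$; $\langle\!\langle a,b\rangle\!\rangle\mathbin{\#}(\lambda x.c)\to b\mathbin{\#\!\#}c[x:=a]$; $(\neg\mathrm{I}\,a)\mathbin{\#}(\neg\mathrm{I}\,b)\to b\mathbin{\#\!\#}a$; $(\Lambda\Diamond.a)\mathbin{\#}\langle\Diamond,b\rangle\to a\mathbin{\#\!\#}b$; $\langle\Diamond,a\rangle\mathbin{\#}(\Lambda\Diamond.b)\to a\mathbin{\#\!\#}b$. $\to_U^*$ is its reflexive-transitive closure. $\mathbf{SN}$ is the set of untyped terms strongly normalizing for $\to_U$. Canonical terms ($\mathbf{CAN}$) are those of the forms $\langle a,b\rangle$, $\mathrm{in}_i(a)$, $\lambda x.a$, $\langle\!\langle a,b\rangle\!\rangle$, $\neg\mathrm{I}(a)$, $\Lambda\Diamond.a$, $\langle\Diamond,a\rangle$. A set $\xi\subseteq\mathbf{SN}$ is closed by reduction if $a\in\xi$, $a\to_U b$ imply $b\in\xi$; complete if for every $a\in\mathbf{SN}$ such that every canonical $b$ with $a\to_U^*b$ lies in $\xi$, we have $a\in\xi$. A reducibility candidate is a subset of $\mathbf{SN}$ closed by reduction and complete; $\mathbf{RC}$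 is the set of all of them. For $X\subseteq\mathbf{CAN}$, its closure is $\overline{X}=\{a\in\mathbf{SN}\mid \forall b\in\mathbf{CAN}.\,(a\to_U^* b\Rightarrow b\in X)\}$. Operations: $\xi_1\times\xi_2=\overline{\{\langle a_1,a_2\rangle\mid a_1\in\xi_1,a_2\in\xi_2\}}$; $\xi_1+\xi_2=\overline{\{\mathrm{in}_i(a)\mid i\in\{1,2\},a\in\xi_i\}}$; $\xi_1\Rightarrow\xi_2=\{a\in\mathbf{SN}\mid\forall b\in\xi_1.\ a\,b\in\xi_2\}$; $\xi_1\ltimes\xi_2=\overline{\{\langle\!\langle a_1,a_2\rangle\!\rangle\mid a_1\in\xi_1,a_2\in\xi_2\}}$; ${\sim}\xi=\overline{\{\neg\mathrm{I}(a)\mid a\in\xi\}}$; $\prod_{i\in I}\xi_i=\{a\in\mathbf{SN}\mid\forall i\in I.\ a[\Diamond]\in\xi_i\}$; $\sum_{i\in I}\xi_i=\overline{\{\langle\Diamond,a\rangle\mid\exists i\in I.\ a\in\xi_i\}}$. -}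

module Defs where

open import Data.Nat using (ℕ; zero; suc)
open import Data.Product using (Σ; ∃; _×_; _,_)
open import Relation.Binary.Construct.Closure.ReflexiveTransitive using (Star)
open import Relation.Binary.PropositionalEquality using (_≡_)

-- Binders: case binds one variable in each branch, lam binds one,
-- colam binds two (x is index 1, y is index 0 in the body),
-- dopen binds one in its body.  The diamond ◇ is a fixed placeholder
-- symbol and carries no data, so  Λ◇.a , a[◇] , ⟨◇,a⟩  are unary.

data Two : Set where
  i₁ i₂ : Two

sel : ∀ {ℓ} {A : Set ℓ} → Two → A → A → A
sel i₁ a b = a
sel i₂ a b = b

infixl 5 _#_

data Term : Set where
  var    : ℕ → Term
  _#_    : Term → Term → Term
  pair   : Term → Term → Term
  proj   : Two → Term → Term
  inj    : Two → Term → Term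
  case   : Term → Term → Term → Term
  lam    : Term → Term
  app    : Term → Term → Term
  copair : Term → Term → Term
  colam  : Term → Term → Term
  negI   : Term → Term
  negE   : Term → Term
  dlam   : Term → Term
  dapp   : Term → Term
  dpair  : Term → Term
  dopen  : Term → Term → Term

ext : (ℕ → ℕ) → ℕ → ℕ
ext ρ zero    = zero
ext ρ (suc n) = suc (ρ n)

rename : (ℕ → ℕ) → Term → Term
rename ρ (var x)       = var (ρ x)
rename ρ (a # b)       = rename ρ a # rename ρ b
rename ρ (pair a b)    = pair (rename ρ a) (rename ρ b)
rename ρ (proj i a)    = proj i (rename ρ a)
rename ρ (inj i a)     = inj i (rename ρ a)
rename ρ (case a b c)  = case (rename ρ a) (rename (ext ρ) b) (rename (ext ρ) c)
rename ρ (lam a)       = lam (rename (ext ρ) a)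
rename ρ (app a b)     = app (rename ρ a) (rename ρ b)
rename ρ (copair a b)  = copair (rename ρ a) (rename ρ b)
rename ρ (colam a b)   = colam (rename ρ a) (rename (ext (ext ρ)) b)
rename ρ (negI a)      = negI (rename ρ a)
rename ρ (negE a)      = negE (rename ρ a)
rename ρ (dlam a)      = dlam (rename ρ a)
rename ρ (dapp a)      = dapp (rename ρ a)
rename ρ (dpair a)     = dpair (rename ρ a)
rename ρ (dopen a b)   = dopen (rename ρ a) (rename (ext ρ) b)

exts : (ℕ → Term) → ℕ → Term
exts σ zero    = var zero
exts σ (suc n) = rename suc (σ n)

subst : (ℕ → Term) → Term → Term
subst σ (var x)       = σ x
subst σ (a # b)       = subst σ a # subst σ b
subst σ (pair a b)    = pair (subst σ a) (subst σ b)
subst σ (proj i a)    = proj i (subst σ a)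
subst σ (inj i a)     = inj i (subst σ a)
subst σ (case a b c)  = case (subst σ a) (subst (exts σ) b) (subst (exts σ) c)
subst σ (lam a)       = lam (subst (exts σ) a)
subst σ (app a b)     = app (subst σ a) (subst σ b)
subst σ (copair a b)  = copair (subst σ a) (subst σ b)
subst σ (colam a b)   = colam (subst σ a) (subst (exts (exts σ)) b)
subst σ (negI a)      = negI (subst σ a)
subst σ (negE a)      = negE (subst σ a)
subst σ (dlam a)      = dlam (subst σ a)
subst σ (dapp a)      = dapp (subst σ a)
subst σ (dpair a)     = dpair (subst σ a)
subst σ (dopen a b)   = dopen (subst σ a) (subst (exts σ) b)

σ₁ : Term → ℕ → Term
σ₁ a zero    = a
σ₁ a (suc n) = var n

_[0≔_] : Term → Term → Term
b [0≔ a ] = subst (σ₁ a) b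

-- b[x:=a₁][y:=a₂] where x is index 1 and y is index 0
σ₂ : Term → Term → ℕ → Term
σ₂ a₁ a₂ zero          = a₂
σ₂ a₁ a₂ (suc zero)    = a₁
σ₂ a₁ a₂ (suc (suc n)) = var n

_##_ : Term → Term → Term
a ## b = app a b # app b a

infix 4 _⟶_

data _⟶_ : Term → Term → Set where
  β-proj  : ∀ i a₁ a₂ → proj i (pair a₁ a₂) ⟶ sel i a₁ a₂
  β-case  : ∀ i a b₁ b₂ → case (inj i a) b₁ b₂ ⟶ (sel i b₁ b₂) [0≔ a ]
  β-lam   : ∀ a b → app (lam a) b ⟶ a [0≔ b ]
  β-colam : ∀ a₁ a₂ b → colam (copair a₁ a₂) b ⟶ subst (σ₂ a₁ a₂) b
  β-neg   : ∀ a → negE (negI a) ⟶ a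
  β-dlam  : ∀ a → dapp (dlam a) ⟶ a
  β-dopen : ∀ a b → dopen (dpair a) b ⟶ b [0≔ a ]
  γ-pair-inj  : ∀ a₁ a₂ i b → pair a₁ a₂ # inj i b ⟶ sel i a₁ a₂ ## b
  γ-inj-pair  : ∀ i a b₁ b₂ → inj i a # pair b₁ b₂ ⟶ a ## sel i b₁ b₂
  γ-lam-copair : ∀ a b c → lam a # copair b c ⟶ (a [0≔ b ]) ## c
  γ-copair-lam : ∀ a b c → copair a b # lam c ⟶ b ## (c [0≔ a ])
  γ-neg       : ∀ a b → negI a # negI b ⟶ b ## a
  γ-dlam-dpair : ∀ a b → dlam a # dpair b ⟶ a ## b
  γ-dpair-dlam : ∀ a b → dpair a # dlam b ⟶ a ## b
  #ˡ      : ∀ {a a′ b} → a ⟶ a′ → a # b ⟶ a′ # b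
  #ʳ      : ∀ {a b b′} → b ⟶ b′ → a # b ⟶ a # b′
  pairˡ   : ∀ {a a′ b} → a ⟶ a′ → pair a b ⟶ pair a′ b
  pairʳ   : ∀ {a b b′} → b ⟶ b′ → pair a b ⟶ pair a b′
  projᶜ   : ∀ {i a a′} → a ⟶ a′ → proj i a ⟶ proj i a′
  injᶜ    : ∀ {i a a′} → a ⟶ a′ → inj i a ⟶ inj i a′
  case₁   : ∀ {a a′ b c} → a ⟶ a′ → case a b c ⟶ case a′ b c
  case₂   : ∀ {a b b′ c} → b ⟶ b′ → case a b c ⟶ case a b′ c
  case₃   : ∀ {a b c c′} → c ⟶ c′ → case a b c ⟶ case a b c′
  lamᶜ    : ∀ {a a′} → a ⟶ a′ → lam a ⟶ lam a′
  appˡ    : ∀ {a a′ b} → a ⟶ a′ → app a b ⟶ app a′ b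
  appʳ    : ∀ {a b b′} → b ⟶ b′ → app a b ⟶ app a b′
  copairˡ : ∀ {a a′ b} → a ⟶ a′ → copair a b ⟶ copair a′ b
  copairʳ : ∀ {a b b′} → b ⟶ b′ → copair a b ⟶ copair a b′
  colamˡ  : ∀ {a a′ b} → a ⟶ a′ → colam a b ⟶ colam a′ b
  colamʳ  : ∀ {a b b′} → b ⟶ b′ → colam a b ⟶ colam a b′
  negIᶜ   : ∀ {a a′} → a ⟶ a′ → negI a ⟶ negI a′
  negEᶜ   : ∀ {a a′} → a ⟶ a′ → negE a ⟶ negE a′
  dlamᶜ   : ∀ {a a′} → a ⟶ a′ → dlam a ⟶ dlam a′
  dappᶜ   : ∀ {a a′} → a ⟶ a′ → dapp a ⟶ dapp a′
  dpairᶜ  : ∀ {a a′} → a ⟶ a′ → dpair a ⟶ dpair a′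
  dopenˡ  : ∀ {a a′ b} → a ⟶ a′ → dopen a b ⟶ dopen a′ b
  dopenʳ  : ∀ {a b b′} → b ⟶ b′ → dopen a b ⟶ dopen a b′

infix 4 _⟶*_
_⟶*_ : Term → Term → Set
_⟶*_ = Star _⟶_

data SN (a : Term) : Set where
  sn : (∀ {b} → a ⟶ b → SN b) → SN a

data CAN : Term → Set where
  can-pair   : ∀ a b → CAN (pair a b)
  can-inj    : ∀ i a → CAN (inj i a)
  can-lam    : ∀ a → CAN (lam a)
  can-copair : ∀ a b → CAN (copair a b)
  can-negI   : ∀ a → CAN (negI a)
  can-dlam   : ∀ a → CAN (dlam a)
  can-dpair  : ∀ a → CAN (dpair a)

TSet : Set₁
TSet = Term → Set

ClosedByReduction : TSet → Set
ClosedByReduction ξ = ∀ {a b} → ξ a → a ⟶ b → ξ b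

Complete : TSet → Set
Complete ξ = ∀ a → SN a → (∀ b → CAN b → a ⟶* b → ξ b) → ξ a

RC : TSet → Set
RC ξ = (∀ a → ξ a → SN a) × ClosedByReduction ξ × Complete ξ

closure : TSet → TSet
closure X a = SN a × (∀ b → CAN b → a ⟶* b → X b)

_×ᶜ_ : TSet → TSet → TSet
ξ₁ ×ᶜ ξ₂ = closure (λ t → Σ Term λ a₁ → Σ Term λ a₂ →
                      (t ≡ pair a₁ a₂) × ξ₁ a₁ × ξ₂ a₂)

_+ᶜ_ : TSet → TSet → TSet
ξ₁ +ᶜ ξ₂ = closure (λ t → Σ Two λ i → Σ Term λ a →
                      (t ≡ inj i a) × sel i ξ₁ ξ₂ a)

_⇒ᶜ_ : TSet → TSet → TSet
(ξ₁ ⇒ᶜ ξ₂) a = SN a × (∀ b → ξ₁ b → ξ₂ (app a b))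

_⋉ᶜ_ : TSet → TSet → TSet
ξ₁ ⋉ᶜ ξ₂ = closure (λ t → Σ Term λ a₁ → Σ Term λ a₂ →
                      (t ≡ copair a₁ a₂) × ξ₁ a₁ × ξ₂ a₂)

∼ᶜ : TSet → TSet
∼ᶜ ξ = closure (λ t → Σ Term λ a → (t ≡ negI a) × ξ a)

Πᶜ : (I : Set) → (I → TSet) → TSet
Πᶜ I ξs a = SN a × (∀ i → ξs i (dapp a))

Σᶜ : (I : Set) → (I → TSet) → TSet
Σᶜ I ξs = closure (λ t → Σ Term λ a → (t ≡ dpair a) × Σ I λ i → ξs i a)

{-# OPTIONS --safe #-}
module Submission where

-- The five operations defined as closures of a set of canonical terms are
-- candidates for free: completeness only asks about canonical reducts, which
-- is exactly what membership in a closure constrains.  For ⇒ and Π the work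
-- is in completeness: a b and a[◇] are never canonical, so they lie in a
-- candidate as soon as all their one-step reducts do.  By induction on the
-- strong normalisation of a and b, the only reduct not handled inductively is
-- the head redex, which comes from a canonical reduct of a, where the
-- hypothesis of completeness applies.

open import Defs
open import Data.Empty using (⊥-elim)
open import Data.Product using (_×_; _,_; proj₁; proj₂)
open import Relation.Nullary using (¬_)
open import Relation.Binary.Construct.Closure.ReflexiveTransitive using (ε; _◅_)

RC⇒SN : ∀ {ξ} → RC ξ → ∀ {a} → ξ a → SN a
RC⇒SN r = proj₁ r _

RC⇒closed : ∀ {ξ} → RC ξ → ClosedByReduction ξ
RC⇒closed r = proj₁ (proj₂ r)

RC⇒complete : ∀ {ξ} → RC ξ → Complete ξ
RC⇒complete r = proj₂ (proj₂ r)

SN-⟶ : ∀ {a b} → SN a → a ⟶ b → SN b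
SN-⟶ (sn f) = f

closed-⟶* : ∀ {ξ} → ClosedByReduction ξ → ∀ {a b} → ξ a → a ⟶* b → ξ b
closed-⟶* cl h ε       = h
closed-⟶* cl h (s ◅ r) = closed-⟶* cl (cl h s) r

CanonicalReductsIn : TSet → TSet
CanonicalReductsIn ξ a = ∀ c → CAN c → a ⟶* c → ξ c

neutral∈RC : ∀ {ξ} → RC ξ → ∀ {a} → ¬ CAN a → (∀ {b} → a ⟶ b → ξ b) → ξ a
neutral∈RC {ξ} r {a} ¬can reducts∈ =
  RC⇒complete r a (sn λ s → RC⇒SN r (reducts∈ s)) canonical∈
  where
  canonical∈ : CanonicalReductsIn ξ a
  canonical∈ c can ε        = ⊥-elim (¬can can)
  canonical∈ c can (s ◅ r′) = closed-⟶* (RC⇒closed r) (reducts∈ s) r′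

closure-RC : ∀ X → RC (closure X)
closure-RC X =
    (λ _ → proj₁)
  , (λ (sa , h) s → SN-⟶ sa s , λ c can r → h c can (s ◅ r))
  , (λ a sa H → sa , λ c can r → proj₂ (H c can r) c can ε)

module _ {ξ₁ ξ₂ : TSet} (r₁ : RC ξ₁) (r₂ : RC ξ₂) where

  app∈ : ∀ {a b} → SN a → SN b → CanonicalReductsIn (ξ₁ ⇒ᶜ ξ₂) a → ξ₁ b →
         ξ₂ (app a b)
  app∈ {a} {b} (sn sa) (sn sb) Ha hb = neutral∈RC r₂ (λ ()) reducts∈
    where
    reducts∈ : ∀ {t} → app a b ⟶ t → ξ₂ t
    reducts∈ (β-lam a′ .b) =
      RC⇒closed r₂ (proj₂ (Ha (lam a′) (can-lam a′) ε) b hb) (β-lam a′ b)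
    reducts∈ (appˡ s) = app∈ (sa s) (sn sb) (λ c can r → Ha c can (s ◅ r)) hb
    reducts∈ (appʳ s) = app∈ (sn sa) (sb s) Ha (RC⇒closed r₁ hb s)

  ⇒ᶜ-RC : RC (ξ₁ ⇒ᶜ ξ₂)
  ⇒ᶜ-RC =
      (λ _ → proj₁)
    , (λ (sa , h) s → SN-⟶ sa s , λ b hb → RC⇒closed r₂ (h b hb) (appˡ s))
    , (λ a sa H → sa , λ b hb → app∈ sa (RC⇒SN r₁ hb) H hb)

module _ {I : Set} {ξs : I → TSet} (rs : ∀ i → RC (ξs i)) where

  dapp∈ : ∀ {a} → SN a → CanonicalReductsIn (Πᶜ I ξs) a → ∀ i → ξs i (dapp a)
  dapp∈ {a} (sn sa) Ha i = neutral∈RC (rs i) (λ ()) reducts∈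
    where
    reducts∈ : ∀ {t} → dapp a ⟶ t → ξs i t
    reducts∈ (β-dlam a′) =
      RC⇒closed (rs i) (proj₂ (Ha (dlam a′) (can-dlam a′) ε) i) (β-dlam a′)
    reducts∈ (dappᶜ s) = dapp∈ (sa s) (λ c can r → Ha c can (s ◅ r)) i

  Πᶜ-RC : RC (Πᶜ I ξs)
  Πᶜ-RC =
      (λ _ → proj₁)
    , (λ (sa , h) s → SN-⟶ sa s , λ i → RC⇒closed (rs i) (h i) (dappᶜ s))
    , (λ a sa H → sa , dapp∈ sa H)

lemma23 : (ξ₁ ξ₂ ξ : TSet) (I : Set) (ξs : I → TSet) →
          RC ξ₁ → RC ξ₂ → RC ξ → (∀ i → RC (ξs i)) →
          RC (ξ₁ ×ᶜ ξ₂) × RC (ξ₁ +ᶜ ξ₂) × RC (ξ₁ ⇒ᶜ ξ₂) × RC (ξ₁ ⋉ᶜ ξ₂) ×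
          RC (∼ᶜ ξ) × RC (Πᶜ I ξs) × RC (Σᶜ I ξs)
lemma23 ξ₁ ξ₂ ξ I ξs r₁ r₂ _ rs =
  closure-RC _ , closure-RC _ , ⇒ᶜ-RC r₁ r₂ , closure-RC _ ,
  closure-RC _ , Πᶜ-RC rs , closure-RC _
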